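{- For every $n\in\mathbb{N}_0$, \[ C_{n}=(-1)^{n}\,y_{6}(0,n;1,2)\sum_{k=0}^{n}B_{k}\,s(n,k), \] where $y_6(0,n;1,2)=\frac{1}{n!}\sum_{k=0}^{n}\binom{n}{k}^{2}$.
   Context: $C_n=\frac{1}{n+1}\binom{2n}{n}$ are the Catalan numbers. $B_k$ are the Bernoulli numbers, defined by $\frac{t}{e^t-1}=\sum_{k\ge0}B_k\frac{t^k}{k!}$. $s(n,k)$ are the Stirling numbers of the first kind, defined by $\frac{(\log(1+t))^k}{k!}=\sum_{n\ge0}s(n,k)\frac{t^n}{n!}$. -}

module Defs where

open import Data.Nat as ℕ using (ℕ; zero; suc; _!)
open import Data.Nat.Combinatorics using (_C_)
open import Data.Nat.Properties using (_!≢0)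
open import Data.Integer as ℤ using (ℤ; +_)
open import Data.Rational using (ℚ; _+_; _*_; -_; _/_; 0ℚ; 1ℚ)
open import Data.Vec using (Vec; []; _∷_; _∷ʳ_; lookup)
open import Data.Fin using (Fin; fromℕ; toℕ)

Σ≤ : ℕ → (ℕ → ℚ) → ℚ
Σ≤ zero    f = f 0
Σ≤ (suc n) f = Σ≤ n f + f (suc n)

ΣFin : (n : ℕ) → (Fin n → ℚ) → ℚ
ΣFin zero    f = 0ℚ
ΣFin (suc n) f = f Fin.zero + ΣFin n (λ i → f (Fin.suc i))

ℕ→ℚ : ℕ → ℚ
ℕ→ℚ n = (+ n) / 1

ℤ→ℚ : ℤ → ℚ
ℤ→ℚ z = z / 1

catalan : ℕ → ℚ
catalan n = (+ ((2 ℕ.* n) C n)) / suc n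

-- Bernoulli numbers with t/(e^t - 1) convention (B₁ = -1/2).
-- Comparing coefficients of t^{m+1}/(m+1)! in t = (e^t - 1) * Σ B_k t^k/k!
-- gives B₀ = 1 and Σ_{j=0}^{m} binom(m+1, j) B_j = 0 for m ≥ 1, i.e.
-- B_m = -(1/(m+1)) Σ_{j<m} binom(m+1, j) B_j.
-- bernoulliVec m = [B₀, …, B_m].
bernoulliVec : (m : ℕ) → Vec ℚ (suc m)
bernoulliVec zero    = 1ℚ ∷ []
bernoulliVec (suc m) = prev ∷ʳ next
  where
  prev : Vec ℚ (suc m)
  prev = bernoulliVec m
  next : ℚ
  next = - ((+ 1 / suc (suc m)) *
            ΣFin (suc m) (λ j → ℕ→ℚ (suc (suc m) C toℕ j) * lookup prev j))

bernoulli : ℕ → ℚ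
bernoulli m = lookup (bernoulliVec m) (fromℕ m)

-- Signed Stirling numbers of the first kind s(n,k):
-- (log(1+t))^k / k! = Σ_n s(n,k) t^n/n!, equivalently
-- x(x-1)…(x-n+1) = Σ_k s(n,k) x^k, i.e. s(n+1,k+1) = s(n,k) - n s(n,k+1).
stirling1 : ℕ → ℕ → ℤ
stirling1 zero    zero    = + 1
stirling1 zero    (suc k) = + 0
stirling1 (suc n) zero    = + 0
stirling1 (suc n) (suc k) = stirling1 n k ℤ.- (+ n) ℤ.* stirling1 n (suc k)

y6-0n12 : ℕ → ℚ
y6-0n12 n = (+ 1 / (n !)) {{n !≢0}} * Σ≤ n (λ k → ℕ→ℚ ((n C k) ℕ.* (n C k)))

sign : ℕ → ℚ
sign zero    = 1ℚ
sign (suc n) = - sign n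

module Submission where

-- Read a coefficient sequence c (of degree < N) as the polynomial p = Σ c_k x^k
-- and let ℬ be the linear functional x^k ↦ B_k.  The Bernoulli recurrence
-- Σ_{j<k} binom(k,j) B_j = [k = 1] says exactly that ℬ(p(x+1)) = ℬ(p) + p'(0).
-- Applied to the falling factorial p = x^{(n+1)} = Σ_k s(n+1,k) x^k, for which
-- p(x+1) = (x+1) x^{(n)} = p + (n+1) x^{(n)} and p'(0) = s(n+1,1) = (-1)^n n!,
-- this gives the key identity (n+1) Σ_k B_k s(n,k) = (-1)^n n!.
-- Together with Vandermonde's identity Σ_k binom(n,k)^2 = binom(2n,n) the
-- theorem is then a rearrangement of rational factors.

open import Defs
open import Data.Nat as ℕ using (ℕ; zero; suc; _<_; _≤_; _∸_; _!; s≤s)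
import Data.Nat.Properties as ℕₚ
open import Data.Nat.Combinatorics
  using (_C_; nCk+nC[k+1]≡[n+1]C[k+1]; nCk≡nC[n∸k]; nC1≡n; nCn≡1; k>n⇒nCk≡0)
open import Data.Integer as ℤ using (ℤ; 1ℤ)
import Data.Integer.Properties as ℤₚ
open import Data.Rational using (ℚ; _+_; _*_; -_; 0ℚ; 1ℚ; _/_; toℚᵘ)
open import Data.Rational.Properties
  using ( toℚᵘ-injective; toℚᵘ-fromℚᵘ; toℚᵘ-homo-+; toℚᵘ-homo-*; toℚᵘ-homo‿-
        ; +-comm; +-assoc; +-identityˡ; +-identityʳ; *-identityˡ
        ; *-zeroˡ; *-zeroʳ; *-distribˡ-+; +-0-group )
import Data.Rational.Unnormalised as ℚᵘ
import Data.Rational.Unnormalised.Properties as ℚᵘₚ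
open import Data.Rational.Solver using (module +-*-Solver)
open +-*-Solver
open import Algebra.Properties.Group +-0-group using () renaming (∙-cancelˡ to +-cancelˡ)
open import Data.Vec using (Vec; []; _∷_; _∷ʳ_; lookup)
open import Data.Fin as Fin using (Fin; toℕ; fromℕ; inject₁)
open import Data.Fin.Properties using (toℕ-fromℕ; toℕ-inject₁)
open import Data.Fin.Relation.Unary.Top using (view; ‵fromℕ; ‵inj₁)
open import Data.Sum using (inj₁; inj₂)
open import Data.Empty using (⊥-elim)
open import Relation.Binary.PropositionalEquality
open ≡-Reasoning

-- A quotient a / (k+1) is the normal form of the
-- unnormalised fraction a/(k+1), so identities between such quotients can be
-- checked on unnormalised representatives, where they are integer identities.

toℚᵘ-/ : ∀ (a : ℤ) k → toℚᵘ (a / suc k) ℚᵘ.≃ ℚᵘ.mkℚᵘ a k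
toℚᵘ-/ a k = toℚᵘ-fromℚᵘ (ℚᵘ.mkℚᵘ a k)

≡-via-ℚᵘ : ∀ {p q : ℚ} (p′ q′ : ℚᵘ.ℚᵘ) →
           toℚᵘ p ℚᵘ.≃ p′ → toℚᵘ q ℚᵘ.≃ q′ → p′ ℚᵘ.≃ q′ → p ≡ q
≡-via-ℚᵘ p′ q′ p≃p′ q≃q′ p′≃q′ =
  toℚᵘ-injective (ℚᵘₚ.≃-trans p≃p′ (ℚᵘₚ.≃-trans p′≃q′ (ℚᵘₚ.≃-sym q≃q′)))

ℤ→ℚ-+ : ∀ a b → ℤ→ℚ (a ℤ.+ b) ≡ ℤ→ℚ a + ℤ→ℚ b
ℤ→ℚ-+ a b = ≡-via-ℚᵘ (ℚᵘ.mkℚᵘ (a ℤ.+ b) 0) (ℚᵘ.mkℚᵘ a 0 ℚᵘ.+ ℚᵘ.mkℚᵘ b 0) (toℚᵘ-/ _ 0)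
  (ℚᵘₚ.≃-trans (toℚᵘ-homo-+ (ℤ→ℚ a) (ℤ→ℚ b)) (ℚᵘₚ.+-cong (toℚᵘ-/ a 0) (toℚᵘ-/ b 0)))
  (ℚᵘ.*≡* (trans (ℤₚ.*-identityʳ _) (sym (trans (ℤₚ.*-identityʳ _)
     (cong₂ ℤ._+_ (ℤₚ.*-identityʳ a) (ℤₚ.*-identityʳ b))))))

ℤ→ℚ-* : ∀ a b → ℤ→ℚ (a ℤ.* b) ≡ ℤ→ℚ a * ℤ→ℚ b
ℤ→ℚ-* a b = ≡-via-ℚᵘ (ℚᵘ.mkℚᵘ (a ℤ.* b) 0) (ℚᵘ.mkℚᵘ a 0 ℚᵘ.* ℚᵘ.mkℚᵘ b 0) (toℚᵘ-/ _ 0)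
  (ℚᵘₚ.≃-trans (toℚᵘ-homo-* (ℤ→ℚ a) (ℤ→ℚ b)) (ℚᵘₚ.*-cong (toℚᵘ-/ a 0) (toℚᵘ-/ b 0)))
  (ℚᵘ.*≡* refl)

ℤ→ℚ-neg : ∀ a → ℤ→ℚ (ℤ.- a) ≡ - ℤ→ℚ a
ℤ→ℚ-neg a = ≡-via-ℚᵘ (ℚᵘ.mkℚᵘ (ℤ.- a) 0) (ℚᵘ.- ℚᵘ.mkℚᵘ a 0) (toℚᵘ-/ _ 0)
  (ℚᵘₚ.≃-trans (toℚᵘ-homo‿- (ℤ→ℚ a)) (ℚᵘₚ.-‿cong (toℚᵘ-/ a 0)))
  (ℚᵘ.*≡* refl)

ℕ→ℚ-+ : ∀ m n → ℕ→ℚ (m ℕ.+ n) ≡ ℕ→ℚ m + ℕ→ℚ n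
ℕ→ℚ-+ m n = ℤ→ℚ-+ (ℤ.+ m) (ℤ.+ n)

ℕ→ℚ-* : ∀ m n → ℕ→ℚ (m ℕ.* n) ≡ ℕ→ℚ m * ℕ→ℚ n
ℕ→ℚ-* m n = trans (cong ℤ→ℚ (ℤₚ.pos-* m n)) (ℤ→ℚ-* (ℤ.+ m) (ℤ.+ n))

ℕ→ℚ-inverse : ∀ d .{{_ : ℕ.NonZero d}} → ℕ→ℚ d * (1ℤ / d) ≡ 1ℚ
ℕ→ℚ-inverse zero    = ⊥-elim (ℕ.≢-nonZero⁻¹ zero refl)
ℕ→ℚ-inverse (suc k) =
  ≡-via-ℚᵘ (ℚᵘ.mkℚᵘ (ℤ.+ suc k) 0 ℚᵘ.* ℚᵘ.mkℚᵘ 1ℤ k) (ℚᵘ.mkℚᵘ 1ℤ 0)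
    (ℚᵘₚ.≃-trans (toℚᵘ-homo-* (ℕ→ℚ (suc k)) (1ℤ / suc k))
                 (ℚᵘₚ.*-cong (toℚᵘ-/ (ℤ.+ suc k) 0) (toℚᵘ-/ 1ℤ k)))
    (toℚᵘ-/ 1ℤ 0)
    (ℚᵘ.*≡* (trans (ℤₚ.*-identityʳ _) (trans (ℤₚ.*-identityʳ (ℤ.+ suc k))
      (sym (trans (ℤₚ.*-identityˡ _) (cong (λ x → ℤ.+ suc x) (ℕₚ.+-identityʳ k)))))))

/-as-* : ∀ a k → (ℤ.+ a) / suc k ≡ ℕ→ℚ a * (1ℤ / suc k)
/-as-* a k =
  ≡-via-ℚᵘ (ℚᵘ.mkℚᵘ (ℤ.+ a) k) (ℚᵘ.mkℚᵘ (ℤ.+ a) 0 ℚᵘ.* ℚᵘ.mkℚᵘ 1ℤ k) (toℚᵘ-/ (ℤ.+ a) k)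
    (ℚᵘₚ.≃-trans (toℚᵘ-homo-* (ℕ→ℚ a) (1ℤ / suc k))
                 (ℚᵘₚ.*-cong (toℚᵘ-/ (ℤ.+ a) 0) (toℚᵘ-/ 1ℤ k)))
    (ℚᵘ.*≡* (cong₂ ℤ._*_ (sym (ℤₚ.*-identityʳ (ℤ.+ a))) (cong (λ x → ℤ.+ suc x) (ℕₚ.+-identityʳ k))))

divide-by-suc : ∀ d x y → ℕ→ℚ (suc d) * x ≡ y → x ≡ (1ℤ / suc d) * y
divide-by-suc d x y eq = begin
  x                                       ≡⟨ sym (*-identityˡ x) ⟩
  1ℚ * x                                  ≡⟨ cong (_* x) (sym (ℕ→ℚ-inverse (suc d))) ⟩
  ℕ→ℚ (suc d) * (1ℤ / suc d) * x
    ≡⟨ solve 3 (λ a b c → a :* b :* c := b :* (a :* c)) refl (ℕ→ℚ (suc d)) (1ℤ / suc d) x ⟩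
  (1ℤ / suc d) * (ℕ→ℚ (suc d) * x)      ≡⟨ cong ((1ℤ / suc d) *_) eq ⟩
  (1ℤ / suc d) * y                       ∎

sign-squared : ∀ n → sign n * sign n ≡ 1ℚ
sign-squared zero    = refl
sign-squared (suc n) =
  trans (solve 1 (λ s → (:- s) :* (:- s) := s :* s) refl (sign n)) (sign-squared n)

Σ< : ℕ → (ℕ → ℚ) → ℚ
Σ< zero    f = 0ℚ
Σ< (suc n) f = Σ< n f + f n

Σ≤-as-Σ< : ∀ n f → Σ≤ n f ≡ Σ< (suc n) f
Σ≤-as-Σ< zero    f = sym (+-identityˡ (f 0))
Σ≤-as-Σ< (suc n) f = cong (_+ f (suc n)) (Σ≤-as-Σ< n f)

Σ<-cong : ∀ n {f g : ℕ → ℚ} → (∀ k → k < n → f k ≡ g k) → Σ< n f ≡ Σ< n g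
Σ<-cong zero    f≡g = refl
Σ<-cong (suc n) f≡g =
  cong₂ _+_ (Σ<-cong n (λ k k<n → f≡g k (ℕₚ.m<n⇒m<1+n k<n))) (f≡g n (ℕₚ.n<1+n n))

Σ<-+ : ∀ n (f g : ℕ → ℚ) → Σ< n (λ k → f k + g k) ≡ Σ< n f + Σ< n g
Σ<-+ zero    f g = refl
Σ<-+ (suc n) f g = trans (cong (_+ (f n + g n)) (Σ<-+ n f g))
  (solve 4 (λ A B a b → (A :+ B) :+ (a :+ b) := (A :+ a) :+ (B :+ b)) refl
    (Σ< n f) (Σ< n g) (f n) (g n))

Σ<-*ˡ : ∀ n c (f : ℕ → ℚ) → Σ< n (λ k → c * f k) ≡ c * Σ< n f
Σ<-*ˡ zero    c f = sym (*-zeroʳ c)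
Σ<-*ˡ (suc n) c f =
  trans (cong (_+ (c * f n)) (Σ<-*ˡ n c f)) (sym (*-distribˡ-+ c (Σ< n f) (f n)))

Σ<-linear : ∀ n (w f g : ℕ → ℚ) a →
  Σ< n (λ k → w k * (f k + a * g k)) ≡ Σ< n (λ k → w k * f k) + a * Σ< n (λ k → w k * g k)
Σ<-linear n w f g a = begin
  Σ< n (λ k → w k * (f k + a * g k))
    ≡⟨ Σ<-cong n (λ k _ → solve 4 (λ w f g a → w :* (f :+ a :* g) := w :* f :+ a :* (w :* g))
                            refl (w k) (f k) (g k) a) ⟩
  Σ< n (λ k → w k * f k + a * (w k * g k))
    ≡⟨ Σ<-+ n _ _ ⟩
  Σ< n (λ k → w k * f k) + Σ< n (λ k → a * (w k * g k))
    ≡⟨ cong (Σ< n (λ k → w k * f k) +_) (Σ<-*ˡ n a (λ k → w k * g k)) ⟩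
  Σ< n (λ k → w k * f k) + a * Σ< n (λ k → w k * g k) ∎

Σ<-zero : ∀ n → Σ< n (λ _ → 0ℚ) ≡ 0ℚ
Σ<-zero zero    = refl
Σ<-zero (suc n) = trans (+-identityʳ _) (Σ<-zero n)

Σ<-front : ∀ n f → Σ< (suc n) f ≡ f 0 + Σ< n (λ k → f (suc k))
Σ<-front zero    f = trans (+-identityˡ (f 0)) (sym (+-identityʳ (f 0)))
Σ<-front (suc n) f = trans (cong (_+ f (suc n)) (Σ<-front n f)) (+-assoc (f 0) _ _)

Σ<-truncate : ∀ n m f → n ≤ m → (∀ k → n ≤ k → f k ≡ 0ℚ) → Σ< m f ≡ Σ< n f
Σ<-truncate n zero    f ℕ.z≤n vanish = refl
Σ<-truncate n (suc m) f n≤1+m vanish with ℕₚ.m≤n⇒m<n∨m≡n n≤1+m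
... | inj₂ refl       = refl
... | inj₁ (s≤s n≤m) =
  trans (cong₂ _+_ (Σ<-truncate n m f n≤m vanish) (vanish m n≤m)) (+-identityʳ _)

Σ<-swap : ∀ n m (f : ℕ → ℕ → ℚ) →
  Σ< n (λ i → Σ< m (λ j → f i j)) ≡ Σ< m (λ j → Σ< n (λ i → f i j))
Σ<-swap zero    m f = sym (Σ<-zero m)
Σ<-swap (suc n) m f = trans (cong (_+ Σ< m (f n)) (Σ<-swap n m f))
  (sym (Σ<-+ m (λ j → Σ< n (λ i → f i j)) (f n)))

-- Coefficient sequences.  timesX c is the coefficient sequence of x·p when c is
-- that of p.

timesX : (ℕ → ℚ) → ℕ → ℚ
timesX f zero    = 0ℚ
timesX f (suc k) = f k

timesX-cong : ∀ {f g} → (∀ k → f k ≡ g k) → ∀ j → timesX f j ≡ timesX g j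
timesX-cong f≡g zero    = refl
timesX-cong f≡g (suc j) = f≡g j

timesX-+ : ∀ f g j → timesX (λ k → f k + g k) j ≡ timesX f j + timesX g j
timesX-+ f g zero    = refl
timesX-+ f g (suc j) = refl

timesX-* : ∀ a f j → timesX (λ k → a * f k) j ≡ a * timesX f j
timesX-* a f zero    = sym (*-zeroʳ a)
timesX-* a f (suc j) = refl

binom : ℕ → ℕ → ℚ
binom n k = ℕ→ℚ (n C k)

pascal : ∀ m k → binom (suc m) k ≡ binom m k + timesX (binom m) k
pascal m zero    = sym (+-identityʳ _)
pascal m (suc k) = begin
  ℕ→ℚ (suc m C suc k)          ≡⟨ cong ℕ→ℚ (sym (nCk+nC[k+1]≡[n+1]C[k+1] m k)) ⟩
  ℕ→ℚ (m C k ℕ.+ m C suc k)    ≡⟨ ℕ→ℚ-+ (m C k) (m C suc k) ⟩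
  binom m k + binom m (suc k)  ≡⟨ +-comm (binom m k) (binom m (suc k)) ⟩
  binom m (suc k) + binom m k  ∎

conv : (ℕ → ℚ) → (ℕ → ℚ) → ℕ → ℚ
conv a b zero    = a 0 * b 0
conv a b (suc r) = a 0 * b (suc r) + conv (λ k → a (suc k)) b r

conv-as-Σ : ∀ r a b → conv a b r ≡ Σ< (suc r) (λ k → a k * b (r ∸ k))
conv-as-Σ zero    a b = sym (+-identityˡ _)
conv-as-Σ (suc r) a b =
  trans (cong (a 0 * b (suc r) +_) (conv-as-Σ r (λ k → a (suc k)) b))
        (sym (Σ<-front (suc r) (λ k → a k * b (suc r ∸ k))))

conv-cong : ∀ r {a a′} b → (∀ k → a k ≡ a′ k) → conv a b r ≡ conv a′ b r
conv-cong zero    b a≡a′ = cong (_* b 0) (a≡a′ 0)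
conv-cong (suc r) b a≡a′ =
  cong₂ _+_ (cong (_* b (suc r)) (a≡a′ 0)) (conv-cong r b (λ k → a≡a′ (suc k)))

conv-+ : ∀ r a a′ b → conv (λ k → a k + a′ k) b r ≡ conv a b r + conv a′ b r
conv-+ zero    a a′ b = solve 3 (λ x y z → (x :+ y) :* z := x :* z :+ y :* z) refl (a 0) (a′ 0) (b 0)
conv-+ (suc r) a a′ b =
  trans (cong ((a 0 + a′ 0) * b (suc r) +_) (conv-+ r (λ k → a (suc k)) (λ k → a′ (suc k)) b))
    (solve 5 (λ x y z u v → (x :+ y) :* z :+ (u :+ v) := (x :* z :+ u) :+ (y :* z :+ v)) refl
      (a 0) (a′ 0) (b (suc r)) (conv (λ k → a (suc k)) b r) (conv (λ k → a′ (suc k)) b r))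

conv-zeroˡ : ∀ r b → conv (λ _ → 0ℚ) b r ≡ 0ℚ
conv-zeroˡ zero    b = *-zeroˡ (b 0)
conv-zeroˡ (suc r) b = trans (cong₂ _+_ (*-zeroˡ (b (suc r))) (conv-zeroˡ r b)) (+-identityʳ 0ℚ)

conv-unitˡ : ∀ r b → conv (binom 0) b r ≡ b r
conv-unitˡ zero    b = *-identityˡ (b 0)
conv-unitˡ (suc r) b =
  trans (cong₂ _+_ (*-identityˡ (b (suc r))) (conv-zeroˡ r b)) (+-identityʳ (b (suc r)))

conv-timesX : ∀ r a b → conv (timesX a) b r ≡ timesX (conv a b) r
conv-timesX zero    a b = *-zeroˡ (b 0)
conv-timesX (suc r) a b = trans (cong (_+ conv a b r) (*-zeroˡ (b (suc r)))) (+-identityˡ _)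

-- Vandermonde's identity: (1+x)^m (1+x)^n = (1+x)^{m+n}.
vandermonde : ∀ m n r → conv (binom m) (binom n) r ≡ binom (m ℕ.+ n) r
vandermonde zero    n r = conv-unitˡ r (binom n)
vandermonde (suc m) n r = begin
  conv (binom (suc m)) (binom n) r
    ≡⟨ conv-cong r (binom n) (pascal m) ⟩
  conv (λ k → binom m k + timesX (binom m) k) (binom n) r
    ≡⟨ conv-+ r (binom m) (timesX (binom m)) (binom n) ⟩
  conv (binom m) (binom n) r + conv (timesX (binom m)) (binom n) r
    ≡⟨ cong₂ _+_ (vandermonde m n r) (conv-timesX r (binom m) (binom n)) ⟩
  binom (m ℕ.+ n) r + timesX (conv (binom m) (binom n)) r
    ≡⟨ cong (binom (m ℕ.+ n) r +_) (timesX-cong (vandermonde m n) r) ⟩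
  binom (m ℕ.+ n) r + timesX (binom (m ℕ.+ n)) r
    ≡⟨ sym (pascal (m ℕ.+ n) r) ⟩
  binom (suc m ℕ.+ n) r ∎

-- Σ_k binom(n,k)^2 = binom(2n,n), by symmetry of binom(n,·) and Vandermonde.
sum-of-squared-binomials : ∀ n →
  Σ≤ n (λ k → ℕ→ℚ ((n C k) ℕ.* (n C k))) ≡ binom (2 ℕ.* n) n
sum-of-squared-binomials n = begin
  Σ≤ n (λ k → ℕ→ℚ ((n C k) ℕ.* (n C k)))
    ≡⟨ Σ≤-as-Σ< n _ ⟩
  Σ< (suc n) (λ k → ℕ→ℚ ((n C k) ℕ.* (n C k)))
    ≡⟨ Σ<-cong (suc n) (λ k k<1+n → trans (ℕ→ℚ-* (n C k) (n C k))
         (cong (λ c → binom n k * ℕ→ℚ c) (nCk≡nC[n∸k] (ℕₚ.≤-pred k<1+n)))) ⟩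
  Σ< (suc n) (λ k → binom n k * binom n (n ∸ k))
    ≡⟨ sym (conv-as-Σ n (binom n) (binom n)) ⟩
  conv (binom n) (binom n) n
    ≡⟨ vandermonde n n n ⟩
  binom (n ℕ.+ n) n
    ≡⟨ cong (λ m → binom (n ℕ.+ m) n) (sym (ℕₚ.+-identityʳ n)) ⟩
  binom (2 ℕ.* n) n ∎

-- Bernoulli numbers.  bernoulliVec m extends bernoulliVec (m-1) by one entry,
-- so every entry of it is the corresponding Bernoulli number.

lookup-∷ʳ-fromℕ : ∀ {A : Set} {n} (xs : Vec A n) x → lookup (xs ∷ʳ x) (fromℕ n) ≡ x
lookup-∷ʳ-fromℕ []       x = refl
lookup-∷ʳ-fromℕ (y ∷ xs) x = lookup-∷ʳ-fromℕ xs x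

lookup-∷ʳ-inject₁ : ∀ {A : Set} {n} (xs : Vec A n) x i → lookup (xs ∷ʳ x) (inject₁ i) ≡ lookup xs i
lookup-∷ʳ-inject₁ (y ∷ xs) x Fin.zero    = refl
lookup-∷ʳ-inject₁ (y ∷ xs) x (Fin.suc i) = lookup-∷ʳ-inject₁ xs x i

lookup-bernoulliVec : ∀ m (i : Fin (suc m)) → lookup (bernoulliVec m) i ≡ bernoulli (toℕ i)
lookup-bernoulliVec zero    Fin.zero = refl
lookup-bernoulliVec (suc m) i with view i
... | ‵fromℕ         = cong bernoulli (sym (toℕ-fromℕ (suc m)))
... | ‵inj₁ {i = j} _ = begin
  lookup (bernoulliVec m ∷ʳ _) (inject₁ j) ≡⟨ lookup-∷ʳ-inject₁ (bernoulliVec m) _ j ⟩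
  lookup (bernoulliVec m) j                ≡⟨ lookup-bernoulliVec m j ⟩
  bernoulli (toℕ j)                        ≡⟨ cong bernoulli (sym (toℕ-inject₁ j)) ⟩
  bernoulli (toℕ (inject₁ j))              ∎

ΣFin-cong : ∀ n {f g : Fin n → ℚ} → (∀ i → f i ≡ g i) → ΣFin n f ≡ ΣFin n g
ΣFin-cong zero    f≡g = refl
ΣFin-cong (suc n) f≡g = cong₂ _+_ (f≡g Fin.zero) (ΣFin-cong n (λ i → f≡g (Fin.suc i)))

ΣFin-as-Σ< : ∀ n (g : ℕ → ℚ) → ΣFin n (λ i → g (toℕ i)) ≡ Σ< n g
ΣFin-as-Σ< zero    g = refl
ΣFin-as-Σ< (suc n) g =
  trans (cong (g 0 +_) (ΣFin-as-Σ< n (λ k → g (suc k)))) (sym (Σ<-front n g))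

binomialPrefix : ℕ → ℚ
binomialPrefix k = Σ< k (λ j → binom k j * bernoulli j)

bernoulli-suc : ∀ m →
  bernoulli (suc m) ≡ - ((1ℤ / suc (suc m)) * Σ< (suc m) (λ j → binom (suc (suc m)) j * bernoulli j))
bernoulli-suc m = trans (lookup-∷ʳ-fromℕ (bernoulliVec m) _)
  (cong (λ x → - ((1ℤ / suc (suc m)) * x))
    (trans (ΣFin-cong (suc m) (λ i → cong (binom (suc (suc m)) (toℕ i) *_) (lookup-bernoulliVec m i)))
           (ΣFin-as-Σ< (suc m) (λ j → binom (suc (suc m)) j * bernoulli j))))

-- Σ_{j<k} binom(k,j) B_j = [k = 1]; the cases k = 0, 1 hold by computation.
binomialPrefix-vanishes : ∀ m → binomialPrefix (suc (suc m)) ≡ 0ℚ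
binomialPrefix-vanishes m = begin
  S + binom (suc (suc m)) (suc m) * bernoulli (suc m)
    ≡⟨ cong₂ (λ a b → S + a * b) (cong ℕ→ℚ binom-penultimate) (bernoulli-suc m) ⟩
  S + ℕ→ℚ (suc (suc m)) * (- ((1ℤ / suc (suc m)) * S))
    ≡⟨ solve 3 (λ X u v → X :+ u :* (:- (v :* X)) := X :+ (:- ((u :* v) :* X))) refl
         S (ℕ→ℚ (suc (suc m))) (1ℤ / suc (suc m)) ⟩
  S + (- ((ℕ→ℚ (suc (suc m)) * (1ℤ / suc (suc m))) * S))
    ≡⟨ cong (λ t → S + (- (t * S))) (ℕ→ℚ-inverse (suc (suc m))) ⟩
  S + (- (1ℚ * S))
    ≡⟨ solve 1 (λ X → X :+ (:- (con 1ℚ :* X)) := con 0ℚ) refl S ⟩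
  0ℚ ∎
  where
  S : ℚ
  S = Σ< (suc m) (λ j → binom (suc (suc m)) j * bernoulli j)
  binom-penultimate : suc (suc m) C suc m ≡ suc (suc m)
  binom-penultimate = trans (nCk≡nC[n∸k] (ℕₚ.n≤1+n (suc m)))
    (trans (cong (suc (suc m) C_) (ℕₚ.m+n∸n≡m 1 m)) (nC1≡n _))

binomialPrefix-weighted : ∀ (c : ℕ → ℚ) m → Σ< (suc (suc m)) (λ k → binomialPrefix k * c k) ≡ c 1
binomialPrefix-weighted c zero    =
  solve 2 (λ a b → (con 0ℚ :+ con 0ℚ :* a) :+ con 1ℚ :* b := b) refl (c 0) (c 1)
binomialPrefix-weighted c (suc m) = begin
  Σ< (suc (suc m)) (λ k → binomialPrefix k * c k) + binomialPrefix (suc (suc m)) * c (suc (suc m))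
    ≡⟨ cong₂ (λ a b → a + b * c (suc (suc m))) (binomialPrefix-weighted c m) (binomialPrefix-vanishes m) ⟩
  c 1 + 0ℚ * c (suc (suc m))
    ≡⟨ trans (cong (c 1 +_) (*-zeroˡ (c (suc (suc m))))) (+-identityʳ (c 1)) ⟩
  c 1 ∎

binomial-sum : ∀ N k → k < N → Σ< N (λ j → binom k j * bernoulli j) ≡ binomialPrefix k + bernoulli k
binomial-sum N k k<N = begin
  Σ< N (λ j → binom k j * bernoulli j)
    ≡⟨ Σ<-truncate (suc k) N _ k<N (λ j k<j →
         trans (cong (λ x → ℕ→ℚ x * bernoulli j) (k>n⇒nCk≡0 k<j)) (*-zeroˡ (bernoulli j))) ⟩
  binomialPrefix k + binom k k * bernoulli k
    ≡⟨ cong (λ x → binomialPrefix k + ℕ→ℚ x * bernoulli k) (nCn≡1 k) ⟩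
  binomialPrefix k + 1ℚ * bernoulli k
    ≡⟨ cong (binomialPrefix k +_) (*-identityˡ (bernoulli k)) ⟩
  binomialPrefix k + bernoulli k ∎

-- The Bernoulli functional ℬ(p) = Σ_k B_k c_k on polynomials of degree < N, and
-- the coefficients Σ_k binom(k,j) c_k of p(x+1).
bernoulliSum : ℕ → (ℕ → ℚ) → ℚ
bernoulliSum N c = Σ< N (λ k → bernoulli k * c k)

binomialShift : ℕ → (ℕ → ℚ) → ℕ → ℚ
binomialShift N c j = Σ< N (λ k → binom k j * c k)

bernoulli-shift : ∀ m (c : ℕ → ℚ) →
  bernoulliSum (suc (suc m)) (binomialShift (suc (suc m)) c) ≡ bernoulliSum (suc (suc m)) c + c 1
bernoulli-shift m c = begin
  Σ< N (λ j → bernoulli j * Σ< N (λ k → binom k j * c k))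
    ≡⟨ Σ<-cong N (λ j _ → sym (Σ<-*ˡ N (bernoulli j) _)) ⟩
  Σ< N (λ j → Σ< N (λ k → bernoulli j * (binom k j * c k)))
    ≡⟨ Σ<-swap N N _ ⟩
  Σ< N (λ k → Σ< N (λ j → bernoulli j * (binom k j * c k)))
    ≡⟨ Σ<-cong N column ⟩
  Σ< N (λ k → binomialPrefix k * c k + bernoulli k * c k)
    ≡⟨ Σ<-+ N _ _ ⟩
  Σ< N (λ k → binomialPrefix k * c k) + bernoulliSum N c
    ≡⟨ cong (_+ bernoulliSum N c) (binomialPrefix-weighted c m) ⟩
  c 1 + bernoulliSum N c
    ≡⟨ +-comm (c 1) _ ⟩
  bernoulliSum N c + c 1 ∎
  where
  N : ℕ
  N = suc (suc m)
  column : ∀ k → k < N →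
    Σ< N (λ j → bernoulli j * (binom k j * c k)) ≡ binomialPrefix k * c k + bernoulli k * c k
  column k k<N = begin
    Σ< N (λ j → bernoulli j * (binom k j * c k))
      ≡⟨ Σ<-cong N (λ j _ → solve 3 (λ b x y → b :* (x :* y) := y :* (x :* b)) refl
                              (bernoulli j) (binom k j) (c k)) ⟩
    Σ< N (λ j → c k * (binom k j * bernoulli j))
      ≡⟨ Σ<-*ˡ N (c k) _ ⟩
    c k * Σ< N (λ j → binom k j * bernoulli j)
      ≡⟨ cong (c k *_) (binomial-sum N k k<N) ⟩
    c k * (binomialPrefix k + bernoulli k)
      ≡⟨ solve 3 (λ y p b → y :* (p :+ b) := p :* y :+ b :* y) refl (c k) (binomialPrefix k) (bernoulli k) ⟩
    binomialPrefix k * c k + bernoulli k * c k ∎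

binomialShift-timesX : ∀ N c j →
  binomialShift (suc N) (timesX c) j ≡ binomialShift N c j + timesX (binomialShift N c) j
binomialShift-timesX N c j = begin
  Σ< (suc N) (λ k → binom k j * timesX c k)
    ≡⟨ Σ<-front N _ ⟩
  binom 0 j * 0ℚ + Σ< N (λ k → binom (suc k) j * c k)
    ≡⟨ cong₂ _+_ (*-zeroʳ (binom 0 j)) (Σ<-cong N (λ k _ → cong (_* c k) (pascal k j))) ⟩
  0ℚ + Σ< N (λ k → (binom k j + timesX (binom k) j) * c k)
    ≡⟨ +-identityˡ _ ⟩
  Σ< N (λ k → (binom k j + timesX (binom k) j) * c k)
    ≡⟨ Σ<-cong N (λ k _ → solve 3 (λ x y z → (x :+ y) :* z := x :* z :+ y :* z) refl
                            (binom k j) (timesX (binom k) j) (c k)) ⟩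
  Σ< N (λ k → binom k j * c k + timesX (binom k) j * c k)
    ≡⟨ Σ<-+ N _ _ ⟩
  binomialShift N c j + Σ< N (λ k → timesX (binom k) j * c k)
    ≡⟨ cong (binomialShift N c j +_) (timesX-outside j) ⟩
  binomialShift N c j + timesX (binomialShift N c) j ∎
  where
  timesX-outside : ∀ j → Σ< N (λ k → timesX (binom k) j * c k) ≡ timesX (binomialShift N c) j
  timesX-outside zero    = trans (Σ<-cong N (λ k _ → *-zeroˡ (c k))) (Σ<-zero N)
  timesX-outside (suc j) = refl

s : ℕ → ℕ → ℚ
s n k = ℤ→ℚ (stirling1 n k)

stirling-rec : ∀ n k → s (suc n) k ≡ timesX (s n) k + (- ℕ→ℚ n) * s n k
stirling-rec zero    zero    = refl
stirling-rec (suc n) zero    = sym (trans (+-identityˡ _) (*-zeroʳ (- ℕ→ℚ (suc n))))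
stirling-rec n       (suc k) = begin
  ℤ→ℚ (stirling1 n k ℤ.- (ℤ.+ n) ℤ.* stirling1 n (suc k))
    ≡⟨ ℤ→ℚ-+ (stirling1 n k) _ ⟩
  s n k + ℤ→ℚ (ℤ.- ((ℤ.+ n) ℤ.* stirling1 n (suc k)))
    ≡⟨ cong (s n k +_) (ℤ→ℚ-neg ((ℤ.+ n) ℤ.* stirling1 n (suc k))) ⟩
  s n k + - ℤ→ℚ ((ℤ.+ n) ℤ.* stirling1 n (suc k))
    ≡⟨ cong (λ t → s n k + - t) (ℤ→ℚ-* (ℤ.+ n) (stirling1 n (suc k))) ⟩
  s n k + - (ℕ→ℚ n * s n (suc k))
    ≡⟨ solve 3 (λ a b c → a :+ :- (b :* c) := a :+ (:- b) :* c) refl (s n k) (ℕ→ℚ n) (s n (suc k)) ⟩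
  s n k + (- ℕ→ℚ n) * s n (suc k) ∎

stirling-vanishes : ∀ n k → n < k → s n k ≡ 0ℚ
stirling-vanishes zero    (suc k) _         = refl
stirling-vanishes (suc n) (suc k) (s≤s n<k) = begin
  s (suc n) (suc k)                    ≡⟨ stirling-rec n (suc k) ⟩
  s n k + (- ℕ→ℚ n) * s n (suc k)
    ≡⟨ cong₂ (λ a b → a + (- ℕ→ℚ n) * b) (stirling-vanishes n k n<k)
             (stirling-vanishes n (suc k) (ℕₚ.m<n⇒m<1+n n<k)) ⟩
  0ℚ + (- ℕ→ℚ n) * 0ℚ                 ≡⟨ trans (+-identityˡ _) (*-zeroʳ (- ℕ→ℚ n)) ⟩
  0ℚ                                   ∎

stirling-linear : ∀ n → s (suc n) 1 ≡ sign n * ℕ→ℚ (n !)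
stirling-linear zero    = refl
stirling-linear (suc n) = begin
  s (suc (suc n)) 1                              ≡⟨ stirling-rec (suc n) 1 ⟩
  0ℚ + (- ℕ→ℚ (suc n)) * s (suc n) 1            ≡⟨ cong (λ t → 0ℚ + (- ℕ→ℚ (suc n)) * t) (stirling-linear n) ⟩
  0ℚ + (- ℕ→ℚ (suc n)) * (sign n * ℕ→ℚ (n !))
    ≡⟨ solve 3 (λ a σ f → con 0ℚ :+ (:- a) :* (σ :* f) := (:- σ) :* (a :* f)) refl
         (ℕ→ℚ (suc n)) (sign n) (ℕ→ℚ (n !)) ⟩
  (- sign n) * (ℕ→ℚ (suc n) * ℕ→ℚ (n !))        ≡⟨ cong (- sign n *_) (sym (ℕ→ℚ-* (suc n) (n !))) ⟩
  sign (suc n) * ℕ→ℚ (suc n !)                   ∎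

falling-shift-rec : ∀ n j →
  binomialShift (suc (suc n)) (s (suc n)) j ≡
  binomialShift (suc n) (s n) j + timesX (binomialShift (suc n) (s n)) j
    + (- ℕ→ℚ n) * binomialShift (suc n) (s n) j
falling-shift-rec n j = begin
  Σ< (suc (suc n)) (λ k → binom k j * s (suc n) k)
    ≡⟨ Σ<-cong (suc (suc n)) (λ k _ → cong (binom k j *_) (stirling-rec n k)) ⟩
  Σ< (suc (suc n)) (λ k → binom k j * (timesX (s n) k + (- ℕ→ℚ n) * s n k))
    ≡⟨ Σ<-linear (suc (suc n)) (λ k → binom k j) (timesX (s n)) (s n) (- ℕ→ℚ n) ⟩
  binomialShift (suc (suc n)) (timesX (s n)) j + (- ℕ→ℚ n) * binomialShift (suc (suc n)) (s n) j
    ≡⟨ cong₂ (λ a b → a + (- ℕ→ℚ n) * b) (binomialShift-timesX (suc n) (s n) j) top-term ⟩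
  binomialShift (suc n) (s n) j + timesX (binomialShift (suc n) (s n)) j
    + (- ℕ→ℚ n) * binomialShift (suc n) (s n) j ∎
  where
  top-term : binomialShift (suc (suc n)) (s n) j ≡ binomialShift (suc n) (s n) j
  top-term = trans (cong (λ t → binomialShift (suc n) (s n) j + binom (suc n) j * t)
                         (stirling-vanishes n (suc n) (ℕₚ.n<1+n n)))
                   (trans (cong (binomialShift (suc n) (s n) j +_) (*-zeroʳ (binom (suc n) j))) (+-identityʳ _))

-- (x+1)^{(n+1)} = (x+1)·x^{(n)}, by induction on n using the two recurrences
-- (x+1)^{(n+2)} = (x-n)·(x+1)^{(n+1)} and x^{(n+1)} = (x-n)·x^{(n)}.
falling-shift : ∀ n j → binomialShift (suc (suc n)) (s (suc n)) j ≡ timesX (s n) j + s n j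
falling-shift zero    zero          = refl
falling-shift zero    (suc zero)    = refl
falling-shift zero    (suc (suc j)) = refl
falling-shift (suc n) j = begin
  binomialShift (suc (suc (suc n))) (s (suc (suc n))) j
    ≡⟨ falling-shift-rec (suc n) j ⟩
  F j + timesX F j + (- ℕ→ℚ (suc n)) * F j
    ≡⟨ cong₂ (λ a b → a + b + (- ℕ→ℚ (suc n)) * a) (falling-shift n j) (timesX-cong (falling-shift n) j) ⟩
  V j + timesX V j + (- ℕ→ℚ (suc n)) * V j
    ≡⟨ cong₂ (λ a b → V j + a + (- b) * V j) (timesX-+ (timesX (s n)) (s n) j) (ℕ→ℚ-+ 1 n) ⟩
  V j + (timesX (timesX (s n)) j + timesX (s n) j) + (- (1ℚ + ℕ→ℚ n)) * V j
    ≡⟨ solve 4 (λ a b c m → (b :+ c) :+ (a :+ b) :+ (:- (con 1ℚ :+ m)) :* (b :+ c)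
                           := (a :+ (:- m) :* b) :+ (b :+ (:- m) :* c)) refl
         (timesX (timesX (s n)) j) (timesX (s n) j) (s n j) (ℕ→ℚ n) ⟩
  (timesX (timesX (s n)) j + (- ℕ→ℚ n) * timesX (s n) j) + (timesX (s n) j + (- ℕ→ℚ n) * s n j)
    ≡⟨ sym (cong₂ _+_ shifted-rec (stirling-rec n j)) ⟩
  timesX (s (suc n)) j + s (suc n) j ∎
  where
  F V : ℕ → ℚ
  F = binomialShift (suc (suc n)) (s (suc n))
  V k = timesX (s n) k + s n k
  shifted-rec : timesX (s (suc n)) j ≡ timesX (timesX (s n)) j + (- ℕ→ℚ n) * timesX (s n) j
  shifted-rec = begin
    timesX (s (suc n)) j
      ≡⟨ timesX-cong (stirling-rec n) j ⟩
    timesX (λ k → timesX (s n) k + (- ℕ→ℚ n) * s n k) j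
      ≡⟨ timesX-+ (timesX (s n)) (λ k → (- ℕ→ℚ n) * s n k) j ⟩
    timesX (timesX (s n)) j + timesX (λ k → (- ℕ→ℚ n) * s n k) j
      ≡⟨ cong (timesX (timesX (s n)) j +_) (timesX-* (- ℕ→ℚ n) (s n) j) ⟩
    timesX (timesX (s n)) j + (- ℕ→ℚ n) * timesX (s n) j ∎

-- Key identity: (n+1) Σ_{k≤n} B_k s(n,k) = (-1)^n n!.  Apply ℬ(p(x+1)) = ℬ(p) + p'(0)
-- to p = x^{(n+1)}, where p(x+1) = p + (n+1)·x^{(n)}, and cancel ℬ(p).
bernoulli-stirling : ∀ n → ℕ→ℚ (suc n) * bernoulliSum (suc n) (s n) ≡ sign n * ℕ→ℚ (n !)
bernoulli-stirling n = +-cancelˡ (bernoulliSum N c) _ _ (begin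
  bernoulliSum N c + ℕ→ℚ (suc n) * bernoulliSum (suc n) (s n)
    ≡⟨ cong (λ t → bernoulliSum N c + ℕ→ℚ (suc n) * t) (sym top-term) ⟩
  bernoulliSum N c + ℕ→ℚ (suc n) * bernoulliSum N (s n)
    ≡⟨ sym (Σ<-linear N bernoulli c (s n) (ℕ→ℚ (suc n))) ⟩
  bernoulliSum N (λ k → c k + ℕ→ℚ (suc n) * s n k)
    ≡⟨ Σ<-cong N (λ k _ → cong (bernoulli k *_) (shifted-coefficient k)) ⟩
  bernoulliSum N (binomialShift N c)
    ≡⟨ bernoulli-shift n c ⟩
  bernoulliSum N c + c 1
    ≡⟨ cong (bernoulliSum N c +_) (stirling-linear n) ⟩
  bernoulliSum N c + sign n * ℕ→ℚ (n !) ∎)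
  where
  N : ℕ
  N = suc (suc n)
  c : ℕ → ℚ
  c = s (suc n)
  top-term : bernoulliSum N (s n) ≡ bernoulliSum (suc n) (s n)
  top-term = trans (cong (λ t → bernoulliSum (suc n) (s n) + bernoulli (suc n) * t)
                         (stirling-vanishes n (suc n) (ℕₚ.n<1+n n)))
                   (trans (cong (bernoulliSum (suc n) (s n) +_) (*-zeroʳ (bernoulli (suc n)))) (+-identityʳ _))
  shifted-coefficient : ∀ k → c k + ℕ→ℚ (suc n) * s n k ≡ binomialShift N c k
  shifted-coefficient k = begin
    c k + ℕ→ℚ (suc n) * s n k
      ≡⟨ cong₂ (λ a b → a + b * s n k) (stirling-rec n k) (ℕ→ℚ-+ 1 n) ⟩
    timesX (s n) k + (- ℕ→ℚ n) * s n k + (1ℚ + ℕ→ℚ n) * s n k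
      ≡⟨ solve 3 (λ a m b → a :+ (:- m) :* b :+ (con 1ℚ :+ m) :* b := a :+ b) refl
           (timesX (s n) k) (ℕ→ℚ n) (s n k) ⟩
    timesX (s n) k + s n k
      ≡⟨ sym (falling-shift n k) ⟩
    binomialShift N c k ∎

-- The theorem: with K = binom(2n,n), y₆ = K/n! and Σ_k B_k s(n,k) = (-1)^n n!/(n+1),
-- so the right-hand side is (-1)^{2n} (n!/n!) K/(n+1) = C_n.
mainTheorem3 : (n : ℕ) →
    catalan n ≡ sign n * y6-0n12 n * Σ≤ n (λ k → bernoulli k * ℤ→ℚ (stirling1 n k))
mainTheorem3 n = begin
  catalan n                                ≡⟨ /-as-* K n ⟩
  ℕ→ℚ K * v
    ≡⟨ solve 2 (λ k v → k :* v := con 1ℚ :* con 1ℚ :* (k :* v)) refl (ℕ→ℚ K) v ⟩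
  1ℚ * 1ℚ * (ℕ→ℚ K * v)
    ≡⟨ cong₂ (λ a b → a * b * (ℕ→ℚ K * v)) (sym (sign-squared n)) (sym (ℕ→ℚ-inverse (n !) {{n ℕₚ.!≢0}})) ⟩
  (σ * σ) * (ℕ→ℚ (n !) * w) * (ℕ→ℚ K * v)
    ≡⟨ solve 5 (λ σ u w k v → (σ :* σ) :* (u :* w) :* (k :* v) := σ :* (w :* k) :* (v :* (σ :* u))) refl
         σ (ℕ→ℚ (n !)) w (ℕ→ℚ K) v ⟩
  σ * (w * ℕ→ℚ K) * (v * (σ * ℕ→ℚ (n !)))
    ≡⟨ cong₂ (λ a b → σ * a * b) (sym y6-as-binom) (sym bernoulli-stirling-sum) ⟩
  sign n * y6-0n12 n * Σ≤ n (λ k → bernoulli k * ℤ→ℚ (stirling1 n k)) ∎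
  where
  K : ℕ
  K = (2 ℕ.* n) C n
  σ v w : ℚ
  σ = sign n
  v = 1ℤ / suc n
  w = (1ℤ / (n !)) {{n ℕₚ.!≢0}}
  y6-as-binom : y6-0n12 n ≡ w * ℕ→ℚ K
  y6-as-binom = cong (w *_) (sum-of-squared-binomials n)
  bernoulli-stirling-sum : Σ≤ n (λ k → bernoulli k * ℤ→ℚ (stirling1 n k)) ≡ v * (σ * ℕ→ℚ (n !))
  bernoulli-stirling-sum = trans (Σ≤-as-Σ< n _) (divide-by-suc n _ _ (bernoulli-stirling n))
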